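{- Let $\alpha\neq\beta$ be two nonzero vectors in $\mathbb{F}_2^n$ and let $f:\mathbb{F}_2^n\to\{0,1\}$ be $f(x)=(\alpha\cdot x)\vee(\beta\cdot x)$. Then $\mathrm{dist}(f,\mathcal{P}_{(111)\text{ -FREE}})\geq\frac14$.
   Context: $\alpha\cdot x=\sum_i\alpha_ix_i \bmod 2$. A function $g:\mathbb{F}_2^n\to\{0,1\}$ is triangle-free if for all $x,y\in\mathbb{F}_2^n$, $(g(x),g(y),g(x+y))\neq(1,1,1)$; $\mathcal{P}_{(111)\text{ -FREE}}$ is the set of such functions. $\mathrm{dist}(f,g)=\Pr_x[f(x)\neq g(x)]$ for uniform $x\in\mathbb{F}_2^n$ and $\mathrm{dist}(f,\mathcal{P})=\min_{g\in\mathcal{P}}\mathrm{dist}(f,g)$. -}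

module Defs where

open import Data.Bool using (Bool; true; false; _xor_; _∧_; _∨_; not; _≟_)
open import Data.Nat using (ℕ; zero; suc; _+_; _*_; _^_; _≤_)
open import Data.Vec using (Vec; []; _∷_; zipWith; foldr; replicate)
open import Data.List using (List; []; _∷_; map; _++_; length; filter)
open import Data.Product using (_×_)
open import Relation.Binary.PropositionalEquality using (_≡_; _≢_)
open import Relation.Nullary using (¬_)

-- F₂ is Bool with xor as addition and ∧ as multiplication; F₂ⁿ = Vec Bool n.
F2^ : ℕ → Set
F2^ n = Vec Bool n

_⊕_ : ∀ {n} → F2^ n → F2^ n → F2^ n
_⊕_ = zipWith _xor_

𝟎 : ∀ {n} → F2^ n
𝟎 {n} = replicate n false

_·_ : ∀ {n} → F2^ n → F2^ n → Bool
α · x = foldr _ _xor_ false (zipWith _∧_ α x)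

allVecs : (n : ℕ) → List (F2^ n)
allVecs zero = [] ∷ []
allVecs (suc n) = map (false ∷_) (allVecs n) ++ map (true ∷_) (allVecs n)

TriangleFree : ∀ {n} → (F2^ n → Bool) → Set
TriangleFree {n} g = ∀ (x y : F2^ n) →
  ¬ (g x ≡ true × g y ≡ true × g (x ⊕ y) ≡ true)

-- number of points x with f x ≠ g x;  dist(f,g) = disagree f g / 2ⁿ
disagree : ∀ {n} → (F2^ n → Bool) → (F2^ n → Bool) → ℕ
disagree {n} f g = length (filter (λ x → (f x xor g x) ≟ true) (allVecs n))

module Submission where

-- Let K = ker α ∩ ker β, a subspace of codimension 2, and pick
-- u, v with α·u = 1, β·u = 0, α·v = 0, β·v = 1.  Then F₂ⁿ is the disjoint
-- union of the four cosets K + a·u + b·v, and f = 1 exactly off K.  For any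
-- x, y the three points  p = πx + u,  q = πy + v,  p + q = π(x + y) + u + v
-- (π the projection onto K along span{u, v}; these are  lift 1 0 x,
-- lift 0 1 y,  lift 1 1 (x + y)  below) lie where f = 1 and form a triangle, so
-- the triangle-free g vanishes on one of them: that point h is a
-- disagreement of f and g.  From h, the coset bits (a, b) of one of x, y and
-- the other vector itself, the pair (x, y) can be reconstructed.  Hence the
-- 2²ⁿ pairs are covered by  |disagreements| · 2ⁿ⁺²  codes, which gives
-- 2ⁿ ≤ 4 · |disagreements|, i.e. dist(f, g) ≥ 1/4.

open import Defs
open import Algebra.Bundles using (CommutativeSemigroup; CommutativeRing)
import Algebra.Properties.CommutativeSemigroup as CommutativeSemigroupProperties
open import Data.Bool using (Bool; true; false; _xor_; _∧_; _∨_; _≟_)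
open import Data.Bool.Properties
  using (xor-∧-commutativeRing; xor-assoc; xor-comm; xor-identityˡ; xor-identityʳ;
         xor-same; ∧-comm; ∧-identityʳ; ∧-zeroʳ; ∧-distribˡ-xor)
open import Data.Empty using (⊥-elim)
open import Data.List using (List; []; _∷_; map; _++_; length; filter; cartesianProductWith)
open import Data.List.Membership.Propositional using (_∈_)
open import Data.List.Membership.Propositional.Properties
  using (∈-map⁺; ∈-map⁻; ∈-++⁺ˡ; ∈-++⁺ʳ; ∈-filter⁺; ∈-cartesianProductWith⁺)
open import Data.List.Properties using (length-++; length-map; length-removeAt′)
open import Data.List.Relation.Unary.All using ([]; lookup)
open import Data.List.Relation.Unary.AllPairs using ([]; _∷_)
open import Data.List.Relation.Unary.Any using (here; there; _─_)
open import Data.List.Relation.Unary.Unique.Propositional using (Unique)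
import Data.List.Relation.Unary.Unique.Propositional.Properties as Unique
open import Data.Nat using (ℕ; zero; suc; _+_; _*_; _^_; _≤_; z≤n; s≤s)
open import Data.Nat.Properties
  using (+-identityʳ; *-cancelʳ-≤; m^n≢0; ^-distribˡ-+-*; module ≤-Reasoning)
open import Data.Nat.Tactic.RingSolver using (solve-∀)
open import Data.Product using (_×_; _,_; Σ; ∃₂)
open import Data.Vec using ([]; _∷_; splitAt)
  renaming (_++_ to _++ᵛ_)
open import Data.Vec.Properties using (zipWith-assoc; zipWith-comm; zipWith-identityˡ; zipWith-identityʳ)
open import Relation.Binary.PropositionalEquality
  using (_≡_; _≢_; refl; sym; trans; cong; cong₂; subst; subst₂; isEquivalence; ≢-sym; module ≡-Reasoning)
open import Relation.Nullary using (¬_)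

-- A duplicate-free list contained in another list is at most as long.
-- This turns the covering argument into an inequality of cardinalities.
length-≤-⊆ : {A : Set} (xs ys : List A) → Unique xs →
             (∀ {x} → x ∈ xs → x ∈ ys) → length xs ≤ length ys
length-≤-⊆ [] ys _ _ = z≤n
length-≤-⊆ (x ∷ xs) ys (x∉xs ∷ xs!) xs⊆ys =
  subst (suc (length xs) ≤_) (sym (length-removeAt′ ys _))
    (s≤s (length-≤-⊆ xs (ys ─ x∈ys) xs! (λ z∈xs →
      ∈-─ ys x∈ys (xs⊆ys (there z∈xs)) (λ z≡x → lookup x∉xs z∈xs (sym z≡x)))))
  where
  x∈ys = xs⊆ys (here refl)
  ∈-─ : ∀ {A : Set} {x z : A} (ys : List A) (x∈ys : x ∈ ys) → z ∈ ys → z ≢ x → z ∈ (ys ─ x∈ys)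
  ∈-─ (y ∷ ys) (here refl) (here refl) z≢x = ⊥-elim (z≢x refl)
  ∈-─ (y ∷ ys) (here refl) (there z∈ys) _   = z∈ys
  ∈-─ (y ∷ ys) (there _)   (here z≡y)   _   = here z≡y
  ∈-─ (y ∷ ys) (there x∈ys) (there z∈ys) z≢x = there (∈-─ ys x∈ys z∈ys z≢x)

length-cartesianProductWith : {A B C : Set} (F : A → B → C) (as : List A) (bs : List B) →
  length (cartesianProductWith F as bs) ≡ length as * length bs
length-cartesianProductWith F [] bs = refl
length-cartesianProductWith F (a ∷ as) bs = begin
  length (map (F a) bs ++ cartesianProductWith F as bs)
    ≡⟨ length-++ (map (F a) bs) ⟩
  length (map (F a) bs) + length (cartesianProductWith F as bs)
    ≡⟨ cong₂ _+_ (length-map (F a) bs) (length-cartesianProductWith F as bs) ⟩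
  length bs + length as * length bs ∎
  where open ≡-Reasoning

allVecs-length : ∀ n → length (allVecs n) ≡ 2 ^ n
allVecs-length zero = refl
allVecs-length (suc n) = begin
  length (map (false ∷_) (allVecs n) ++ map (true ∷_) (allVecs n))
    ≡⟨ length-++ (map (false ∷_) (allVecs n)) ⟩
  length (map (false ∷_) (allVecs n)) + length (map (true ∷_) (allVecs n))
    ≡⟨ cong₂ _+_ (length-map (false ∷_) (allVecs n)) (length-map (true ∷_) (allVecs n)) ⟩
  length (allVecs n) + length (allVecs n)
    ≡⟨ cong₂ _+_ (allVecs-length n) (trans (allVecs-length n) (sym (+-identityʳ (2 ^ n)))) ⟩
  2 ^ n + (2 ^ n + 0) ∎
  where open ≡-Reasoning

allVecs-complete : ∀ {n} (x : F2^ n) → x ∈ allVecs n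
allVecs-complete [] = here refl
allVecs-complete (false ∷ x) = ∈-++⁺ˡ (∈-map⁺ (false ∷_) (allVecs-complete x))
allVecs-complete (true ∷ x) = ∈-++⁺ʳ (map (false ∷_) _) (∈-map⁺ (true ∷_) (allVecs-complete x))

∷-injectiveʳ : ∀ {n} {b : Bool} {x y : F2^ n} → _≡_ {A = F2^ (suc n)} (b ∷ x) (b ∷ y) → x ≡ y
∷-injectiveʳ refl = refl

allVecs-unique : ∀ n → Unique (allVecs n)
allVecs-unique zero = [] ∷ []
allVecs-unique (suc n) =
  Unique.++⁺ (Unique.map⁺ ∷-injectiveʳ (allVecs-unique n))
             (Unique.map⁺ ∷-injectiveʳ (allVecs-unique n)) halves-disjoint
  where
  halves-disjoint : ∀ {x} → ¬ (x ∈ map (false ∷_) (allVecs n) × x ∈ map (true ∷_) (allVecs n))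
  halves-disjoint (p , q) with ∈-map⁻ (false ∷_) p | ∈-map⁻ (true ∷_) q
  ... | _ , _ , refl | _ , _ , ()

⊕-self : ∀ {n} (x : F2^ n) → x ⊕ x ≡ 𝟎
⊕-self [] = refl
⊕-self (b ∷ x) = cong₂ _∷_ (xor-same b) (⊕-self x)

module _ {n : ℕ} where

  ⊕-assoc : (x y z : F2^ n) → (x ⊕ y) ⊕ z ≡ x ⊕ (y ⊕ z)
  ⊕-assoc = zipWith-assoc xor-assoc

  ⊕-comm : (x y : F2^ n) → x ⊕ y ≡ y ⊕ x
  ⊕-comm = zipWith-comm xor-comm

  ⊕-identityˡ : (x : F2^ n) → 𝟎 ⊕ x ≡ x
  ⊕-identityˡ = zipWith-identityˡ xor-identityˡ

  ⊕-identityʳ : (x : F2^ n) → x ⊕ 𝟎 ≡ x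
  ⊕-identityʳ = zipWith-identityʳ xor-identityʳ

  -- packaged to reuse the library's rearrangement laws
  ⊕-commutativeSemigroup : CommutativeSemigroup _ _
  ⊕-commutativeSemigroup = record
    { isCommutativeSemigroup = record
      { isSemigroup = record
        { isMagma = record { isEquivalence = isEquivalence ; ∙-cong = cong₂ _⊕_ }
        ; assoc = ⊕-assoc }
      ; comm = ⊕-comm } }

  ⊕-interchange : (x y z w : F2^ n) → (x ⊕ y) ⊕ (z ⊕ w) ≡ (x ⊕ z) ⊕ (y ⊕ w)
  ⊕-interchange = CommutativeSemigroupProperties.interchange ⊕-commutativeSemigroup

  ⊕-cancel : (x y : F2^ n) → (x ⊕ y) ⊕ y ≡ x
  ⊕-cancel x y = begin
    (x ⊕ y) ⊕ y ≡⟨ ⊕-assoc x y y ⟩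
    x ⊕ (y ⊕ y) ≡⟨ cong (x ⊕_) (⊕-self y) ⟩
    x ⊕ 𝟎       ≡⟨ ⊕-identityʳ x ⟩
    x           ∎
    where open ≡-Reasoning

  ⊕≡𝟎⇒≡ : (x y : F2^ n) → x ⊕ y ≡ 𝟎 → x ≡ y
  ⊕≡𝟎⇒≡ x y x⊕y≡𝟎 = begin
    x           ≡⟨ sym (⊕-cancel x y) ⟩
    (x ⊕ y) ⊕ y ≡⟨ cong (_⊕ y) x⊕y≡𝟎 ⟩
    𝟎 ⊕ y       ≡⟨ ⊕-identityˡ y ⟩
    y           ∎
    where open ≡-Reasoning

xor-interchange : (a b c d : Bool) → (a xor b) xor (c xor d) ≡ (a xor c) xor (b xor d)
xor-interchange = CommutativeSemigroupProperties.interchange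
  (CommutativeRing.+-commutativeSemigroup xor-∧-commutativeRing)

·-comm : ∀ {n} (x y : F2^ n) → x · y ≡ y · x
·-comm [] [] = refl
·-comm (a ∷ x) (b ∷ y) = cong₂ _xor_ (∧-comm a b) (·-comm x y)

·-linear : ∀ {n} (γ x y : F2^ n) → γ · (x ⊕ y) ≡ (γ · x) xor (γ · y)
·-linear [] [] [] = refl
·-linear (c ∷ γ) (a ∷ x) (b ∷ y) =
  trans (cong₂ _xor_ (∧-distribˡ-xor c a b) (·-linear γ x y))
        (xor-interchange (c ∧ a) (c ∧ b) (γ · x) (γ · y))

·-linearˡ : ∀ {n} (α β x : F2^ n) → (α ⊕ β) · x ≡ (α · x) xor (β · x)
·-linearˡ α β x = trans (·-comm (α ⊕ β) x)
  (trans (·-linear x α β) (cong₂ _xor_ (·-comm x α) (·-comm x β)))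

·-zeroʳ : ∀ {n} (γ : F2^ n) → γ · 𝟎 ≡ false
·-zeroʳ [] = refl
·-zeroʳ (c ∷ γ) = cong₂ _xor_ (∧-zeroʳ c) (·-zeroʳ γ)

nonzero-witness : ∀ {n} (γ : F2^ n) → γ ≢ 𝟎 → Σ (F2^ n) λ w → γ · w ≡ true
nonzero-witness [] γ≢𝟎 = ⊥-elim (γ≢𝟎 refl)
nonzero-witness (true ∷ γ) _ = true ∷ 𝟎 , cong (true xor_) (·-zeroʳ γ)
nonzero-witness (false ∷ γ) γ≢𝟎 with nonzero-witness γ (λ γ≡𝟎 → γ≢𝟎 (cong (false ∷_) γ≡𝟎))
... | w , γw = false ∷ w , γw

-- Two different functionals, the first nonzero, are separated by some u:
-- α·u = 1 and β·u = 0.  Take w with α·w = 1; if β·w = 1 as well, correct it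
-- by a vector w' on which α and β differ.
separating-vector : ∀ {n} (α β : F2^ n) → α ≢ 𝟎 → α ≢ β →
  Σ (F2^ n) λ u → α · u ≡ true × β · u ≡ false
separating-vector α β α≢𝟎 α≢β with nonzero-witness α α≢𝟎
... | w , αw with β · w in βw
...   | false = w , αw , βw
...   | true with nonzero-witness (α ⊕ β) (λ α⊕β≡𝟎 → α≢β (⊕≡𝟎⇒≡ α β α⊕β≡𝟎))
...     | w' , α⊕βw' with α · w' in αw' | β · w' in βw' | trans (sym (·-linearˡ α β w')) α⊕βw'
...       | true  | false | _ = w' , αw' , βw'
...       | false | true  | _ = w ⊕ w' ,
  trans (·-linear α w w') (cong₂ _xor_ αw αw') ,
  trans (·-linear β w w') (cong₂ _xor_ βw βw')
...       | true  | true  | ()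
...       | false | false | ()

scale : ∀ {n} → Bool → F2^ n → F2^ n
scale false w = 𝟎
scale true  w = w

·-scale : ∀ {n} (γ : F2^ n) b w → γ · scale b w ≡ b ∧ (γ · w)
·-scale γ false w = ·-zeroʳ γ
·-scale γ true  w = refl

scale-xor : ∀ {n} a b (w : F2^ n) → scale (a xor b) w ≡ scale a w ⊕ scale b w
scale-xor false false w = sym (⊕-identityˡ 𝟎)
scale-xor false true  w = sym (⊕-identityˡ w)
scale-xor true  false w = sym (⊕-identityʳ w)
scale-xor true  true  w = sym (⊕-self w)

module Cosets {n} (α β u v : F2^ n)
  (αu : α · u ≡ true) (βu : β · u ≡ false) (αv : α · v ≡ false) (βv : β · v ≡ true) where

  open ≡-Reasoning

  offset : Bool → Bool → F2^ n
  offset a b = scale a u ⊕ scale b v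

  ·-offset-α : ∀ a b → α · offset a b ≡ a
  ·-offset-α a b = begin
    α · (scale a u ⊕ scale b v)                  ≡⟨ ·-linear α (scale a u) (scale b v) ⟩
    (α · scale a u) xor (α · scale b v)          ≡⟨ cong₂ _xor_ (·-scale α a u) (·-scale α b v) ⟩
    (a ∧ α · u) xor (b ∧ α · v)                  ≡⟨ cong₂ (λ p q → (a ∧ p) xor (b ∧ q)) αu αv ⟩
    (a ∧ true) xor (b ∧ false)                   ≡⟨ cong₂ _xor_ (∧-identityʳ a) (∧-zeroʳ b) ⟩
    a xor false                                  ≡⟨ xor-identityʳ a ⟩
    a                                            ∎

  ·-offset-β : ∀ a b → β · offset a b ≡ b
  ·-offset-β a b = begin
    β · (scale a u ⊕ scale b v)                  ≡⟨ ·-linear β (scale a u) (scale b v) ⟩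
    (β · scale a u) xor (β · scale b v)          ≡⟨ cong₂ _xor_ (·-scale β a u) (·-scale β b v) ⟩
    (a ∧ β · u) xor (b ∧ β · v)                  ≡⟨ cong₂ (λ p q → (a ∧ p) xor (b ∧ q)) βu βv ⟩
    (a ∧ false) xor (b ∧ true)                   ≡⟨ cong₂ _xor_ (∧-zeroʳ a) (∧-identityʳ b) ⟩
    false xor b                                  ≡⟨ xor-identityˡ b ⟩
    b                                            ∎

  offset-xor : ∀ a b a' b' → offset (a xor a') (b xor b') ≡ offset a b ⊕ offset a' b'
  offset-xor a b a' b' = begin
    scale (a xor a') u ⊕ scale (b xor b') v
      ≡⟨ cong₂ _⊕_ (scale-xor a a' u) (scale-xor b b' v) ⟩
    (scale a u ⊕ scale a' u) ⊕ (scale b v ⊕ scale b' v)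
      ≡⟨ ⊕-interchange (scale a u) (scale a' u) (scale b v) (scale b' v) ⟩
    (scale a u ⊕ scale b v) ⊕ (scale a' u ⊕ scale b' v) ∎

  -- the projection x ↦ x + (α·x)·u + (β·x)·v onto K along span{u, v}
  π : F2^ n → F2^ n
  π x = x ⊕ offset (α · x) (β · x)

  π-linear : ∀ x y → π (x ⊕ y) ≡ π x ⊕ π y
  π-linear x y = begin
    (x ⊕ y) ⊕ offset (α · (x ⊕ y)) (β · (x ⊕ y))
      ≡⟨ cong ((x ⊕ y) ⊕_) (cong₂ offset (·-linear α x y) (·-linear β x y)) ⟩
    (x ⊕ y) ⊕ offset (α · x xor α · y) (β · x xor β · y)
      ≡⟨ cong ((x ⊕ y) ⊕_) (offset-xor (α · x) (β · x) (α · y) (β · y)) ⟩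
    (x ⊕ y) ⊕ (offset (α · x) (β · x) ⊕ offset (α · y) (β · y))
      ≡⟨ ⊕-interchange x y _ _ ⟩
    π x ⊕ π y ∎

  ·-π-α : ∀ x → α · π x ≡ false
  ·-π-α x = trans (·-linear α x _) (trans (cong (α · x xor_) (·-offset-α (α · x) (β · x))) (xor-same (α · x)))

  ·-π-β : ∀ x → β · π x ≡ false
  ·-π-β x = trans (·-linear β x _) (trans (cong (β · x xor_) (·-offset-β (α · x) (β · x))) (xor-same (β · x)))

  π-offset : ∀ a b → π (offset a b) ≡ 𝟎
  π-offset a b = trans (cong₂ (λ p q → offset a b ⊕ offset p q) (·-offset-α a b) (·-offset-β a b))
                       (⊕-self (offset a b))

  π-idempotent : ∀ x → π (π x) ≡ π x
  π-idempotent x = trans (cong₂ (λ p q → π x ⊕ offset p q) (·-π-α x) (·-π-β x))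
                         (trans (cong (π x ⊕_) (⊕-identityˡ 𝟎)) (⊕-identityʳ (π x)))

  lift : Bool → Bool → F2^ n → F2^ n
  lift a b k = π k ⊕ offset a b

  ·-lift-α : ∀ a b k → α · lift a b k ≡ a
  ·-lift-α a b k = trans (·-linear α (π k) _) (cong₂ _xor_ (·-π-α k) (·-offset-α a b))

  ·-lift-β : ∀ a b k → β · lift a b k ≡ b
  ·-lift-β a b k = trans (·-linear β (π k) _) (cong₂ _xor_ (·-π-β k) (·-offset-β a b))

  π-lift : ∀ a b k → π (lift a b k) ≡ π k
  π-lift a b k = begin
    π (π k ⊕ offset a b)      ≡⟨ π-linear (π k) (offset a b) ⟩
    π (π k) ⊕ π (offset a b)  ≡⟨ cong₂ _⊕_ (π-idempotent k) (π-offset a b) ⟩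
    π k ⊕ 𝟎                   ≡⟨ ⊕-identityʳ (π k) ⟩
    π k                       ∎

  lift-coordinates : ∀ x → lift (α · x) (β · x) x ≡ x
  lift-coordinates x = ⊕-cancel x (offset (α · x) (β · x))

  lift-⊕ : ∀ a b a' b' k k' → lift a b k ⊕ lift a' b' k' ≡ lift (a xor a') (b xor b') (k ⊕ k')
  lift-⊕ a b a' b' k k' = begin
    (π k ⊕ offset a b) ⊕ (π k' ⊕ offset a' b')
      ≡⟨ ⊕-interchange (π k) _ (π k') _ ⟩
    (π k ⊕ π k') ⊕ (offset a b ⊕ offset a' b')
      ≡⟨ cong₂ _⊕_ (sym (π-linear k k')) (sym (offset-xor a b a' b')) ⟩
    π (k ⊕ k') ⊕ offset (a xor a') (b xor b') ∎

  lift-cong : ∀ a b {k k'} → π k ≡ π k' → lift a b k ≡ lift a b k'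
  lift-cong a b πk≡πk' = cong (_⊕ offset a b) πk≡πk'

disagreements : ∀ {n} → (F2^ n → Bool) → (F2^ n → Bool) → List (F2^ n)
disagreements {n} f g = filter (λ x → (f x xor g x) ≟ true) (allVecs n)

-- the integer version of 2²ⁿ ≤ m · 2ⁿ⁺² ⇒ 2ⁿ ≤ 4m
cancel-2^n : ∀ n m → 2 ^ (n + n) ≤ m * 2 ^ (2 + n) → 2 ^ n ≤ 4 * m
cancel-2^n n m 2^2n≤ = *-cancelʳ-≤ (2 ^ n) (4 * m) (2 ^ n) {{m^n≢0 2 n}}
  (subst₂ _≤_ (^-distribˡ-+-* 2 n n) (regroup (2 ^ n) m) 2^2n≤)
  where
  regroup : ∀ k m → m * (2 * (2 * k)) ≡ (4 * m) * k
  regroup = solve-∀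

module Covering {n} (α β u v : F2^ n)
  (αu : α · u ≡ true) (βu : β · u ≡ false) (αv : α · v ≡ false) (βv : β · v ≡ true)
  (g : F2^ n → Bool) (g-free : TriangleFree g) where

  open Cosets α β u v αu βu αv βv

  f : F2^ n → Bool
  f x = (α · x) ∨ (β · x)

  D : List (F2^ n)
  D = disagreements f g

  lift-∈-D : ∀ a b k → a ∨ b ≡ true → g (lift a b k) ≡ false → lift a b k ∈ D
  lift-∈-D a b k a∨b g≡false = ∈-filter⁺ _ (allVecs-complete (lift a b k))
    (cong₂ _xor_ (trans (cong₂ _∨_ (·-lift-α a b k) (·-lift-β a b k)) a∨b) g≡false)

  -- Reconstruction of a pair (x, y) from a disagreement h (in the coset
  -- (1,0), (0,1) or (1,1), given by the bits of h) and a code (a, b, s):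
  -- s is the vector of the pair not determined by h, (a, b) the coset bits
  -- of the other one.
  decodeIn : Bool → Bool → F2^ n → Bool → Bool → F2^ n → F2^ (n + n)
  decodeIn true  false h a b s = lift a b h ++ᵛ s
  decodeIn false true  h a b s = s ++ᵛ lift a b h
  decodeIn true  true  h a b s = s ++ᵛ lift a b (h ⊕ s)
  decodeIn false false h a b s = s ++ᵛ s   -- never used: f h = 1 for h ∈ D

  decode : F2^ n → F2^ (2 + n) → F2^ (n + n)
  decode h (a ∷ b ∷ s) = decodeIn (α · h) (β · h) h a b s

  decode-lift : ∀ c d k a b s → decode (lift c d k) (a ∷ b ∷ s) ≡ decodeIn c d (lift c d k) a b s
  decode-lift c d k a b s = cong₂ (λ p q → decodeIn p q (lift c d k) a b s) (·-lift-α c d k) (·-lift-β c d k)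

  Covered : F2^ (n + n) → Set
  Covered w = ∃₂ λ h c → h ∈ D × decode h c ≡ w

  covered-by-x : ∀ x y → g (lift true false x) ≡ false → Covered (x ++ᵛ y)
  covered-by-x x y g≡false = lift true false x , (α · x ∷ β · x ∷ y) , lift-∈-D true false x refl g≡false ,
    (begin
      decode (lift true false x) (α · x ∷ β · x ∷ y)  ≡⟨ decode-lift true false x _ _ y ⟩
      lift (α · x) (β · x) (lift true false x) ++ᵛ y  ≡⟨ cong (_++ᵛ y) (lift-cong (α · x) (β · x) (π-lift true false x)) ⟩
      lift (α · x) (β · x) x ++ᵛ y                    ≡⟨ cong (_++ᵛ y) (lift-coordinates x) ⟩
      x ++ᵛ y                                         ∎)
    where open ≡-Reasoning

  covered-by-y : ∀ x y → g (lift false true y) ≡ false → Covered (x ++ᵛ y)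
  covered-by-y x y g≡false = lift false true y , (α · y ∷ β · y ∷ x) , lift-∈-D false true y refl g≡false ,
    (begin
      decode (lift false true y) (α · y ∷ β · y ∷ x)  ≡⟨ decode-lift false true y _ _ x ⟩
      x ++ᵛ lift (α · y) (β · y) (lift false true y)  ≡⟨ cong (x ++ᵛ_) (lift-cong (α · y) (β · y) (π-lift false true y)) ⟩
      x ++ᵛ lift (α · y) (β · y) y                    ≡⟨ cong (x ++ᵛ_) (lift-coordinates y) ⟩
      x ++ᵛ y                                         ∎)
    where open ≡-Reasoning

  covered-by-sum : ∀ x y → g (lift true true (x ⊕ y)) ≡ false → Covered (x ++ᵛ y)
  covered-by-sum x y g≡false = h , (α · y ∷ β · y ∷ x) , lift-∈-D true true (x ⊕ y) refl g≡false ,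
    (begin
      decode h (α · y ∷ β · y ∷ x)       ≡⟨ decode-lift true true (x ⊕ y) _ _ x ⟩
      x ++ᵛ lift (α · y) (β · y) (h ⊕ x) ≡⟨ cong (x ++ᵛ_) (lift-cong (α · y) (β · y) π[h⊕x]≡πy) ⟩
      x ++ᵛ lift (α · y) (β · y) y       ≡⟨ cong (x ++ᵛ_) (lift-coordinates y) ⟩
      x ++ᵛ y                            ∎)
    where
    open ≡-Reasoning
    h = lift true true (x ⊕ y)
    π[h⊕x]≡πy : π (h ⊕ x) ≡ π y
    π[h⊕x]≡πy = begin
      π (h ⊕ x)           ≡⟨ π-linear h x ⟩
      π h ⊕ π x           ≡⟨ cong (_⊕ π x) (π-lift true true (x ⊕ y)) ⟩
      π (x ⊕ y) ⊕ π x     ≡⟨ sym (π-linear (x ⊕ y) x) ⟩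
      π ((x ⊕ y) ⊕ x)     ≡⟨ cong π (trans (cong (_⊕ x) (⊕-comm x y)) (⊕-cancel y x)) ⟩
      π y                 ∎

  -- The three vertices form a triangle on which f = 1, so g vanishes on one.
  covered : ∀ w → Covered w
  covered w with splitAt n w
  ... | x , y , refl with g (lift true false x) in gp
  ...   | false = covered-by-x x y gp
  ...   | true with g (lift false true y) in gq
  ...     | false = covered-by-y x y gq
  ...     | true with g (lift true true (x ⊕ y)) in gpq
  ...       | false = covered-by-sum x y gpq
  ...       | true = ⊥-elim (g-free (lift true false x) (lift false true y)
                       (gp , gq , trans (cong g (lift-⊕ true false false true x y)) gpq))

  lower-bound : 2 ^ n ≤ 4 * length D
  lower-bound = cancel-2^n n (length D) (begin
    2 ^ (n + n)                                              ≡⟨ sym (allVecs-length (n + n)) ⟩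
    length (allVecs (n + n))                                 ≤⟨ length-≤-⊆ _ _ (allVecs-unique (n + n)) all-decoded ⟩
    length (cartesianProductWith decode D (allVecs (2 + n))) ≡⟨ length-cartesianProductWith decode D (allVecs (2 + n)) ⟩
    length D * length (allVecs (2 + n))                      ≡⟨ cong (length D *_) (allVecs-length (2 + n)) ⟩
    length D * 2 ^ (2 + n)                                   ∎)
    where
    open ≤-Reasoning
    all-decoded : ∀ {w} → w ∈ allVecs (n + n) → w ∈ cartesianProductWith decode D (allVecs (2 + n))
    all-decoded {w} _ with covered w
    ... | h , c , h∈D , refl = ∈-cartesianProductWith⁺ decode h∈D (allVecs-complete c)

proposition4p5 : (n : ℕ) (α β : F2^ n) → α ≢ 𝟎 → β ≢ 𝟎 → α ≢ β →
    (g : F2^ n → Bool) → TriangleFree g →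
    2 ^ n ≤ 4 * disagree (λ x → (α · x) ∨ (β · x)) g
proposition4p5 n α β α≢𝟎 β≢𝟎 α≢β g g-free
  with separating-vector α β α≢𝟎 α≢β | separating-vector β α β≢𝟎 (≢-sym α≢β)
... | u , αu , βu | v , βv , αv = Covering.lower-bound α β u v αu βu αv βv g g-free
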